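{- Let $\mathfrak{A}$ be a finitely branching, chromatic structure interpreting $\Sigma$, let $\Pi$ be a set of 1-types over $\Sigma$, let $B\subseteq A$ be a $\Pi$-group, and let $\omega$ be a permutation of $B$. Then there exists a structure $\mathfrak{A}'$ interpreting $\Sigma$ over the domain $A$ such that $\mathfrak{A}'$ is a $(\Pi,B)$-approximation to $\mathfrak{A}$ and $\mathrm{pr}^{\mathfrak A'}_\Pi[\omega(b)]=\mathrm{pr}^{\mathfrak A}_\Pi[b]$ for all $b\in B$.
   Context: Structures are finite or countably infinite; $\Sigma$ is a finite signature of unary and binary predicates (no constants, no function symbols; equality is a logical constant) with a distinguished set of binary "counting predicates" $f_1,\dots,f_m$. A 1-type is a maximal consistent set of equality-free literals in the variable $x$ only; a 2-type is a maximal consistent set of equality-free literals in $x,y$; $\tau^{ -1}$ swaps $x,y$. $\mathrm{tp}^{\mathfrak A}[a]$ is the 1-type of $a$; for distinct $a,b$, $\mathrm{tp}^{\mathfrak A}[a,b]$ is the 2-type of $(a,b)$; a 2-type is realized in $\mathfrak A$ if it equals $\mathrm{tp}^{\mathfrak A}[a,b]$ for some distinct $a,b$. A 2-type $\tau$ is a message-type if $f_h(x,y)\in\tau$ for some $h$; invertible if $\tau$ and $\tau^{ -1}$ are both message-types. Enumerate the message-types as $\mu_1,\dots,\mu_M$. $\mathfrak A$ is finitely branching if there is $Y\in\mathbb N$ such that for all $a$ and $h$, $|\{a'\ne a:\mathfrak A\models f_h[a,a']\}|\le Y$. $\mathfrak A$ is chromatic if (1) distinct $a,a'$ with $\mathrm{tp}^{\mathfrak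 A}[a,a']$ an invertible message-type have distinct 1-types, and (2) pairwise distinct $a,a',a''$ with $\mathrm{tp}^{\mathfrak A}[a,a']$ and $\mathrm{tp}^{\mathfrak A}[a',a'']$ invertible message-types satisfy $\mathrm{tp}^{\mathfrak A}[a]\ne\mathrm{tp}^{\mathfrak A}[a'']$. For a set $\Pi$ of 1-types, $A_\Pi=\{a: \mathrm{tp}^{\mathfrak A}[a]\in\Pi\}$ and $\Pi^c$ is the set of 1-types over $\Sigma$ not in $\Pi$. For finitely branching $\mathfrak A$ and $a\in A$: the $\Pi$-profile $\mathrm{pr}^{\mathfrak A}_\Pi[a]\in\mathbb N^M$ has $j$-th entry $|\{b\in A_\Pi: b\ne a,\ \mathrm{tp}^{\mathfrak A}[a,b]=\mu_j\}|$ (the profile $\mathrm{pr}^{\mathfrak A}[a]$ is the case $\Pi=$ all 1-types); the $\Pi$-count $\mathrm{ct}^{\mathfrak A}_\Pi[a]\in\mathbb N^m$ has $h$-th entry $|\{b\in A_\Pi: b\ne a,\ \mathfrak A\models f_h[a,b]\}|$. A set $B\subseteq A$ is a $\Pi$-group if all its elements have the same 1-type and the same $\Pi$-count. For finitely branching chromatic $\mathfrak A$, a set $\Pi$ of 1-types and $B\subseteq A$, a structure $\mathfrak A'$ interpreting $\Sigma$ over domain $A$ is a $(\Pi,B)$-approximation to $\mathfrak A$ if (i) $\mathfrak A'$ is chromatic; (ii) every 2-type realized in $\mathfrak A'$ is realized in $\mathfrak A$; (iii) for all $a\in A$: $\mathrm{tp}^{\mathfrak A'}[a]=\mathrm{tp}^{\mathfrak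 A}[a]$; $\mathrm{pr}^{\mathfrak A'}_{\Pi^c}[a]=\mathrm{pr}^{\mathfrak A}_{\Pi^c}[a]$; if $a\notin B$ then $\mathrm{pr}^{\mathfrak A'}[a]=\mathrm{pr}^{\mathfrak A}[a]$; if $a\in B$ then $\mathrm{ct}^{\mathfrak A'}_\Pi[a]=\mathrm{ct}^{\mathfrak A}_\Pi[a]$. -}

module Defs where

open import Data.Nat using (ℕ; _≤_)
open import Data.Bool using (Bool; true; false; not; T)
open import Data.Fin using (Fin)
open import Data.Vec using (Vec; tabulate)
open import Data.List using (List; length)
open import Data.List.Membership.Propositional using (_∈_)
open import Data.List.Relation.Unary.All using (All)
open import Data.List.Relation.Unary.Unique.Propositional using (Unique)
open import Data.Product using (Σ; ∃; _×_; _,_; proj₁)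
open import Relation.Binary.PropositionalEquality using (_≡_; _≢_)
open import Function.Bundles using (_⇔_; _↔_)
open import Function.Definitions using (Injective)

-- Signatures: nU unary predicates, nB binary predicates, and m
-- distinguished (pairwise distinct) binary counting predicates f₁..fₘ.

record Signature : Set where
  field
    nU  : ℕ
    nB  : ℕ
    m   : ℕ
    cnt : Fin m → Fin nB
    cnt-inj : Injective _≡_ _≡_ cnt
open Signature public

record Str (Σ' : Signature) (A : Set) : Set where
  field
    unary  : Fin (nU Σ') → A → Bool
    binary : Fin (nB Σ') → A → A → Bool
open Str public

Countable : Set → Set
Countable A = Σ (A → ℕ) (λ e → Injective _≡_ _≡_ e)

module _ {Σ' : Signature} where

  -- 1-types: a maximal consistent set of equality-free literals in x is
  -- determined by the truth values of P(x) (P unary) and R(x,x) (R binary).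
  record OneType : Set where
    constructor oneType
    field
      ux  : Vec Bool (nU Σ')
      bxx : Vec Bool (nB Σ')

  record TwoType : Set where
    constructor twoType
    field
      ux  : Vec Bool (nU Σ')
      uy  : Vec Bool (nU Σ')
      bxx : Vec Bool (nB Σ')
      bxy : Vec Bool (nB Σ')
      byx : Vec Bool (nB Σ')
      byy : Vec Bool (nB Σ')

  _⁻¹ : TwoType → TwoType
  twoType ux uy bxx bxy byx byy ⁻¹ = twoType uy ux byy byx bxy bxx

  HasF : Fin (m Σ') → TwoType → Set
  HasF h τ = T (Data.Vec.lookup (TwoType.bxy τ) (cnt Σ' h))

  IsMessageType : TwoType → Set
  IsMessageType τ = ∃ λ h → HasF h τ

  IsInvertible : TwoType → Set
  IsInvertible τ = IsMessageType τ × IsMessageType (τ ⁻¹)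

  module _ {A : Set} (𝔄 : Str Σ' A) where

    tp₁ : A → OneType
    tp₁ a = oneType (tabulate (λ p → unary 𝔄 p a)) (tabulate (λ r → binary 𝔄 r a a))

    tp₂ : A → A → TwoType
    tp₂ a b = twoType (tabulate (λ p → unary 𝔄 p a)) (tabulate (λ p → unary 𝔄 p b))
                      (tabulate (λ r → binary 𝔄 r a a)) (tabulate (λ r → binary 𝔄 r a b))
                      (tabulate (λ r → binary 𝔄 r b a)) (tabulate (λ r → binary 𝔄 r b b))

    Realized : TwoType → Set
    Realized τ = Σ A λ a → Σ A λ b → a ≢ b × tp₂ a b ≡ τ

    FinitelyBranching : Set
    FinitelyBranching =
      ∃ λ (Y : ℕ) → ∀ (a : A) (h : Fin (m Σ')) (xs : List A) → Unique xs →
        All (λ a' → a' ≢ a × T (binary 𝔄 (cnt Σ' h) a a')) xs → length xs ≤ Y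

    Chromatic : Set
    Chromatic =
      (∀ a a' → a ≢ a' → IsInvertible (tp₂ a a') → tp₁ a ≢ tp₁ a')
      × (∀ a a' a'' → a ≢ a' → a' ≢ a'' → a ≢ a'' →
           IsInvertible (tp₂ a a') → IsInvertible (tp₂ a' a'') → tp₁ a ≢ tp₁ a'')

    -- Sets of 1-types are given by their characteristic function.
    -- Elements of the Π-profile set of a for message-type τ:
    --   { b ∈ A_Π : b ≠ a, tp[a,b] = τ }
    PrSet : (OneType → Bool) → A → TwoType → A → Set
    PrSet Π a τ b = T (Π (tp₁ b)) × b ≢ a × tp₂ a b ≡ τ

    CtSet : (OneType → Bool) → A → Fin (m Σ') → A → Set
    CtSet Π a h b = T (Π (tp₁ b)) × b ≢ a × T (binary 𝔄 (cnt Σ' h) a b)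

  allTypes : OneType → Bool
  allTypes _ = true

  complement : (OneType → Bool) → OneType → Bool
  complement Π t = not (Π t)

module _ {A : Set} where

  HasCard : (A → Set) → ℕ → Set
  HasCard P n = Σ (List A) λ xs → length xs ≡ n × Unique xs × (∀ a → (a ∈ xs) ⇔ P a)

  SameCard : (A → Set) → (A → Set) → Set
  SameCard P Q = ∀ n → HasCard P n ⇔ HasCard Q n

module _ {Σ' : Signature} {A : Set} where

  SameProfile : (OneType → Bool) → Str Σ' A → A → Str Σ' A → A → Set
  SameProfile Π 𝔄' a' 𝔄 a =
    ∀ (τ : TwoType {Σ'}) → IsMessageType τ → SameCard (PrSet 𝔄' Π a' τ) (PrSet 𝔄 Π a τ)

  SameCount : (OneType → Bool) → Str Σ' A → A → Str Σ' A → A → Set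
  SameCount Π 𝔄' a' 𝔄 a =
    ∀ (h : Fin (m Σ')) → SameCard (CtSet 𝔄' Π a' h) (CtSet 𝔄 Π a h)

  IsGroup : Str Σ' A → (OneType → Bool) → (A → Bool) → Set
  IsGroup 𝔄 Π B = ∀ b b' → T (B b) → T (B b') →
    tp₁ 𝔄 b ≡ tp₁ 𝔄 b' × SameCount Π 𝔄 b 𝔄 b'

  IsApproximation : (OneType → Bool) → (A → Bool) → Str Σ' A → Str Σ' A → Set
  IsApproximation Π B 𝔄' 𝔄 =
    Chromatic 𝔄'
    × (∀ a b → a ≢ b → Realized 𝔄 (tp₂ 𝔄' a b))
    × (∀ a → tp₁ 𝔄' a ≡ tp₁ 𝔄 a
         × SameProfile (complement Π) 𝔄' a 𝔄 a
         × (B a ≡ false → SameProfile allTypes 𝔄' a 𝔄 a)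
         × (B a ≡ true → SameCount Π 𝔄' a 𝔄 a))

Elem : {A : Set} → (A → Bool) → Set
Elem {A} B = Σ A λ a → T (B a)

Permutation : Set → Set
Permutation X = X ↔ X

-- Let σ extend ω⁻¹ by the identity outside B; it preserves 1-types because B is a Π-group.
-- 𝔄' reads a pair x, y through σ, i.e. gives it the 2-type of (σ x, σ y) in 𝔄, unless one of
-- x, y lies in B and the other outside A_Π. Every 2-type of 𝔄' is thus the 2-type in 𝔄 of an
-- injective image of the pair, which gives (ii), and chromaticity transfers from 𝔄 along a map
-- reading both edges of a path a, a', a'' the same way. Such a map exists unless a' and one of
-- its neighbours lie in B; then they share a 1-type, which condition (1) already forbids.
-- Rows of 𝔄' are rearranged rows of 𝔄: for a ∈ B the Π-part of the row becomes that of σ a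
-- and the rest is unchanged, while for a ∉ B the row is permuted by y ↦ σ y on the pairs read
-- through σ. Counts at a ∈ B become those of σ a, equal to those of a as B is a Π-group.

module Submission where

open import Defs
open import Data.Bool using (Bool; true; false; not; T; _∧_; _∨_)
open import Data.Bool.Properties using (T-≡; T-not-≡; T-irrelevant; ∧-comm; ∧-identityʳ; ∨-zeroʳ)
open import Data.List using (map)
open import Data.List.Properties using (length-map)
open import Data.List.Membership.Propositional using (_∈_)
open import Data.List.Membership.Propositional.Properties using (∈-map⁺; ∈-map⁻)
open import Data.List.Relation.Unary.Unique.Propositional.Properties using (map⁺)
open import Data.Product using (Σ; _×_; _,_; proj₁; proj₂)
open import Data.Sum using (_⊎_; inj₁; inj₂)
open import Data.Vec using (lookup)
open import Data.Vec.Properties using (lookup∘tabulate; tabulate-cong)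
open import Function using (_∘_)
open import Function.Bundles using (Inverse; Injection; Equivalence; _↔_; _⇔_; mk⇔; mk↔ₛ′)
open import Function.Construct.Composition using (_⇔-∘_)
open import Function.Construct.Identity using (↔-id)
open import Function.Construct.Symmetry using (↔-sym)
open import Function.Definitions using (Injective)
open import Function.Properties.Inverse using (↔⇒↣)
open import Relation.Nullary using (¬_; yes; no; contradiction)
open import Relation.Nullary.Decidable using (T?)
open import Relation.Binary.PropositionalEquality

↔-injective : {A : Set} (g : A ↔ A) → Injective _≡_ _≡_ (Inverse.to g)
↔-injective g = Injection.injective (↔⇒↣ g)

hasCard-↔ : {A : Set} {P Q : A → Set} (g : A ↔ A) →
  (∀ x → P x ⇔ Q (Inverse.to g x)) → ∀ {n} → HasCard P n → HasCard Q n
hasCard-↔ {P = P} {Q} g P⇔Q (xs , length-xs , unique-xs , ∈xs⇔P) =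
  map to xs , trans (length-map to xs) length-xs , map⁺ (↔-injective g) unique-xs ,
  λ y → mk⇔ (∈⇒Q y) (Q⇒∈ y)
  where
  open Inverse g
  ∈⇒Q : ∀ y → y ∈ map to xs → Q y
  ∈⇒Q y y∈ with ∈-map⁻ to y∈
  ... | x , x∈xs , refl = Equivalence.to (P⇔Q x) (Equivalence.to (∈xs⇔P x) x∈xs)
  Q⇒∈ : ∀ y → Q y → y ∈ map to xs
  Q⇒∈ y q = subst (_∈ map to xs) (strictlyInverseˡ y)
    (∈-map⁺ to (Equivalence.from (∈xs⇔P (from y))
      (Equivalence.from (P⇔Q (from y)) (subst Q (sym (strictlyInverseˡ y)) q))))

sameCard-↔ : {A : Set} {P Q : A → Set} (g : A ↔ A) →
  (∀ x → P x ⇔ Q (Inverse.to g x)) → SameCard P Q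
sameCard-↔ {P = P} {Q} g P⇔Q n = mk⇔ (hasCard-↔ g P⇔Q) (hasCard-↔ (↔-sym g) Q⇔P)
  where
  open Inverse g
  Q⇔P : ∀ y → Q y ⇔ P (from y)
  Q⇔P y = mk⇔ (λ q → Equivalence.from (P⇔Q (from y)) (subst Q (sym (strictlyInverseˡ y)) q))
              (λ p → subst Q (strictlyInverseˡ y) (Equivalence.to (P⇔Q (from y)) p))

sameCard-trans : {A : Set} {P Q R : A → Set} → SameCard P Q → SameCard Q R → SameCard P R
sameCard-trans P≈Q Q≈R n = Q≈R n ⇔-∘ P≈Q n

module _ {Σ' : Signature} where

  -- tp₁ 𝔄 x and tp₁ 𝔄 y are definitionally the source and target of tp₂ 𝔄 x y.
  source target : TwoType {Σ'} → OneType {Σ'}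
  source τ = oneType (TwoType.ux τ) (TwoType.bxx τ)
  target τ = oneType (TwoType.uy τ) (TwoType.byy τ)

  module _ {D A : Set} {𝔅 : Str Σ' D} {𝔄 : Str Σ' A} where

    tp₂-cong : ∀ {x y u v} → tp₁ 𝔅 x ≡ tp₁ 𝔄 u → tp₁ 𝔅 y ≡ tp₁ 𝔄 v →
      (∀ r → binary 𝔅 r x y ≡ binary 𝔄 r u v) → (∀ r → binary 𝔅 r y x ≡ binary 𝔄 r v u) →
      tp₂ 𝔅 x y ≡ tp₂ 𝔄 u v
    tp₂-cong x≡u y≡v xy≡uv yx≡vu =
      twoType-cong (cong OneType.ux x≡u) (cong OneType.ux y≡v) (cong OneType.bxx x≡u)
                   (tabulate-cong xy≡uv) (tabulate-cong yx≡vu) (cong OneType.bxx y≡v)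
      where
      twoType-cong : ∀ {a₁ a₂ a₃ a₄ a₅ a₆ b₁ b₂ b₃ b₄ b₅ b₆} →
        a₁ ≡ b₁ → a₂ ≡ b₂ → a₃ ≡ b₃ → a₄ ≡ b₄ → a₅ ≡ b₅ → a₆ ≡ b₆ →
        twoType {Σ'} a₁ a₂ a₃ a₄ a₅ a₆ ≡ twoType b₁ b₂ b₃ b₄ b₅ b₆
      twoType-cong refl refl refl refl refl refl = refl

    binary-≡ : ∀ {x y u v} → tp₂ 𝔅 x y ≡ tp₂ 𝔄 u v → ∀ r → binary 𝔅 r x y ≡ binary 𝔄 r u v
    binary-≡ {x} {y} {u} {v} xy≡uv r = begin
      binary 𝔅 r x y                   ≡⟨ lookup∘tabulate (λ r → binary 𝔅 r x y) r ⟨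
      lookup (TwoType.bxy (tp₂ 𝔅 x y)) r ≡⟨ cong (λ τ → lookup (TwoType.bxy τ) r) xy≡uv ⟩
      lookup (TwoType.bxy (tp₂ 𝔄 u v)) r ≡⟨ lookup∘tabulate (λ r → binary 𝔄 r u v) r ⟩
      binary 𝔄 r u v                   ∎
      where open ≡-Reasoning

    module _ (ψ : D → A) (ψ-injective : Injective _≡_ _≡_ ψ) where

      realized-transfer : ∀ {a a'} → a ≢ a' → tp₂ 𝔅 a a' ≡ tp₂ 𝔄 (ψ a) (ψ a') →
        Realized 𝔄 (tp₂ 𝔅 a a')
      realized-transfer a≢a' eq = _ , _ , a≢a' ∘ ψ-injective , sym eq

      chromatic₁-transfer : Chromatic 𝔄 → ∀ {a a'} → a ≢ a' →
        tp₂ 𝔅 a a' ≡ tp₂ 𝔄 (ψ a) (ψ a') →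
        IsInvertible (tp₂ 𝔅 a a') → tp₁ 𝔅 a ≢ tp₁ 𝔅 a'
      chromatic₁-transfer (chromatic₁ , _) a≢a' eq inv same =
        chromatic₁ _ _ (a≢a' ∘ ψ-injective) (subst IsInvertible eq inv)
          (trans (cong source (sym eq)) (trans same (cong target eq)))

      chromatic₂-transfer : Chromatic 𝔄 → ∀ {a a' a''} → a ≢ a' → a' ≢ a'' → a ≢ a'' →
        tp₂ 𝔅 a a' ≡ tp₂ 𝔄 (ψ a) (ψ a') → tp₂ 𝔅 a' a'' ≡ tp₂ 𝔄 (ψ a') (ψ a'') →
        IsInvertible (tp₂ 𝔅 a a') → IsInvertible (tp₂ 𝔅 a' a'') → tp₁ 𝔅 a ≢ tp₁ 𝔅 a''
      chromatic₂-transfer (_ , chromatic₂) a≢a' a'≢a'' a≢a'' eq eq' inv inv' same =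
        chromatic₂ _ _ _ (a≢a' ∘ ψ-injective) (a'≢a'' ∘ ψ-injective) (a≢a'' ∘ ψ-injective)
          (subst IsInvertible eq inv) (subst IsInvertible eq' inv')
          (trans (cong source (sym eq)) (trans same (cong target eq')))

module RowTransport {Σ' : Signature} {A : Set} (𝔅 𝔄 : Str Σ' A) (Π₀ : OneType {Σ'} → Bool)
  (g : A ↔ A) {b a : A} (g-base : Inverse.to g b ≡ a)
  (g-tp₁ : ∀ y → tp₁ 𝔄 (Inverse.to g y) ≡ tp₁ 𝔅 y)
  (row : ∀ y → T (Π₀ (tp₁ 𝔅 y)) → tp₂ 𝔅 b y ≡ tp₂ 𝔄 a (Inverse.to g y)) where

  open Inverse g using (to)

  private
    sameCard-row : {Φ𝔅 Φ𝔄 : A → Set} → (∀ y → T (Π₀ (tp₁ 𝔅 y)) → Φ𝔅 y ⇔ Φ𝔄 (to y)) →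
      SameCard (λ y → T (Π₀ (tp₁ 𝔅 y)) × y ≢ b × Φ𝔅 y) (λ z → T (Π₀ (tp₁ 𝔄 z)) × z ≢ a × Φ𝔄 z)
    sameCard-row Φ⇔Φ = sameCard-↔ g λ y → mk⇔
      (λ (y∈Π , y≢b , φ) → subst (T ∘ Π₀) (sym (g-tp₁ y)) y∈Π ,
                           (λ gy≡a → y≢b (↔-injective g (trans gy≡a (sym g-base)))) ,
                           Equivalence.to (Φ⇔Φ y y∈Π) φ)
      (λ (gy∈Π , gy≢a , φ) → let y∈Π = subst (T ∘ Π₀) (g-tp₁ y) gy∈Π in
                           y∈Π , (λ y≡b → gy≢a (trans (cong to y≡b) g-base)) ,
                           Equivalence.from (Φ⇔Φ y y∈Π) φ)

  sameProfile-↔ : SameProfile Π₀ 𝔅 b 𝔄 a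
  sameProfile-↔ τ _ = sameCard-row λ y y∈Π → mk⇔ (trans (sym (row y y∈Π))) (trans (row y y∈Π))

  sameCount-↔ : SameCount Π₀ 𝔅 b 𝔄 a
  sameCount-↔ h = sameCard-row λ y y∈Π →
    mk⇔ (subst T (binary-≡ {𝔅 = 𝔅} {𝔄 = 𝔄} (row y y∈Π) _))
        (subst T (sym (binary-≡ {𝔅 = 𝔅} {𝔄 = 𝔄} (row y y∈Π) _)))

module Twisting {Σ' : Signature} {A : Set} (𝔄 : Str Σ' A)
  (σ : A ↔ A) (σ-tp₁ : ∀ x → tp₁ 𝔄 (Inverse.to σ x) ≡ tp₁ 𝔄 x)
  (κ : A → A → Bool) (κ-sym : ∀ x y → κ x y ≡ κ y x) where

  open Inverse σ using (to; from; strictlyInverseˡ)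

  twistIf : Bool → A → A
  twistIf true  x = to x
  twistIf false x = x

  twisted : Str Σ' A
  twisted = record
    { unary  = unary 𝔄
    ; binary = λ r x y → binary 𝔄 r (twistIf (κ x y) x) (twistIf (κ x y) y)
    }

  twistIf-injective : ∀ c → Injective _≡_ _≡_ (twistIf c)
  twistIf-injective true  = ↔-injective σ
  twistIf-injective false = λ eq → eq

  twistIf-tp₁ : ∀ c x → tp₁ 𝔄 (twistIf c x) ≡ tp₁ 𝔄 x
  twistIf-tp₁ true  = σ-tp₁
  twistIf-tp₁ false _ = refl

  tp₁-twisted : ∀ x → tp₁ twisted x ≡ tp₁ 𝔄 x
  tp₁-twisted x = cong (oneType _) (cong OneType.bxx (twistIf-tp₁ (κ x x) x))

  tp₁-twistIf : ∀ c x → tp₁ 𝔄 (twistIf c x) ≡ tp₁ twisted x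
  tp₁-twistIf c x = trans (twistIf-tp₁ c x) (sym (tp₁-twisted x))

  tp₂-twisted : ∀ x y → tp₂ twisted x y ≡ tp₂ 𝔄 (twistIf (κ x y) x) (twistIf (κ x y) y)
  tp₂-twisted x y =
    tp₂-cong {𝔅 = twisted} {𝔄 = 𝔄} (sym (tp₁-twistIf (κ x y) x)) (sym (tp₁-twistIf (κ x y) y))
      (λ _ → refl) (λ r → cong (λ c → binary 𝔄 r (twistIf c y) (twistIf c x)) (κ-sym y x))

  twistedBy : ∀ c {x y} → twistIf (κ x y) x ≡ twistIf c x → twistIf (κ x y) y ≡ twistIf c y →
    tp₂ twisted x y ≡ tp₂ 𝔄 (twistIf c x) (twistIf c y)
  twistedBy c {x} {y} x≡ y≡ = trans (tp₂-twisted x y) (cong₂ (tp₂ 𝔄) x≡ y≡)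

  twistedBy-κ : ∀ {c x y} → κ x y ≡ c → tp₂ twisted x y ≡ tp₂ 𝔄 (twistIf c x) (twistIf c y)
  twistedBy-κ {x = x} {y} refl = tp₂-twisted x y

  twisted-realizes : ∀ a b → a ≢ b → Realized 𝔄 (tp₂ twisted a b)
  twisted-realizes a b a≢b =
    realized-transfer (twistIf (κ a b)) (twistIf-injective (κ a b)) a≢b (tp₂-twisted a b)

  twisted-chromatic₁ : Chromatic 𝔄 → ∀ a a' → a ≢ a' →
    IsInvertible (tp₂ twisted a a') → tp₁ twisted a ≢ tp₁ twisted a'
  twisted-chromatic₁ chromatic a a' a≢a' =
    chromatic₁-transfer (twistIf (κ a a')) (twistIf-injective (κ a a')) chromatic a≢a'
      (tp₂-twisted a a')

  twistBy : (c : A → Bool) → (∀ y → c (to y) ≡ c y) → A ↔ A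
  twistBy c c-invariant = mk↔ₛ′ (λ y → twistIf (c y) y) (λ y → untwistIf (c y) y) to∘from from∘to
    where
    untwistIf : Bool → A → A
    untwistIf true  y = from y
    untwistIf false y = y
    twist-untwist : ∀ b y → twistIf b (untwistIf b y) ≡ y
    twist-untwist true  = strictlyInverseˡ
    twist-untwist false _ = refl
    untwist-twist : ∀ b y → untwistIf b (twistIf b y) ≡ y
    untwist-twist true  = Inverse.strictlyInverseʳ σ
    untwist-twist false _ = refl
    c-twist : ∀ b y → c (twistIf b y) ≡ c y
    c-twist true  = c-invariant
    c-twist false _ = refl
    c-untwist : ∀ b y → c (untwistIf b y) ≡ c y
    c-untwist true  y = trans (sym (c-invariant (from y))) (cong c (strictlyInverseˡ y))
    c-untwist false _ = refl
    to∘from : ∀ y → twistIf (c (untwistIf (c y) y)) (untwistIf (c y) y) ≡ y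
    to∘from y rewrite c-untwist (c y) y = twist-untwist (c y) y
    from∘to : ∀ y → untwistIf (c (twistIf (c y) y)) (twistIf (c y) y) ≡ y
    from∘to y rewrite c-twist (c y) y = untwist-twist (c y) y

module _ {A : Set} (B : A → Bool) where

  extend : (Elem B → Elem B) → A → A
  extend f x with T? (B x)
  ... | yes x∈B = proj₁ (f (x , x∈B))
  ... | no  _   = x

  extend-∈ : ∀ f {x} (x∈B : T (B x)) → extend f x ≡ proj₁ (f (x , x∈B))
  extend-∈ f {x} x∈B with T? (B x)
  ... | yes x∈B' = cong (λ p → proj₁ (f (x , p))) (T-irrelevant x∈B' x∈B)
  ... | no  x∉B  = contradiction x∈B x∉B

  extend-∉ : ∀ f {x} → ¬ T (B x) → extend f x ≡ x
  extend-∉ f {x} x∉B with T? (B x)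
  ... | yes x∈B = contradiction x∈B x∉B
  ... | no  _   = refl

  extend-B : ∀ f x → B (extend f x) ≡ B x
  extend-B f x with T? (B x)
  ... | yes x∈B = trans (Equivalence.to T-≡ (proj₂ (f (x , x∈B)))) (sym (Equivalence.to T-≡ x∈B))
  ... | no  _   = refl

  extend-inverse : ∀ f g → (∀ z → g (f z) ≡ z) → ∀ x → extend g (extend f x) ≡ x
  extend-inverse f g g∘f x with T? (B x)
  ... | yes x∈B = trans (extend-∈ g (proj₂ (f (x , x∈B)))) (cong proj₁ (g∘f (x , x∈B)))
  ... | no  x∉B = extend-∉ g x∉B

  extendPermutation : Permutation (Elem B) → A ↔ A
  extendPermutation ω = mk↔ₛ′ (extend (Inverse.to ω)) (extend (Inverse.from ω))
    (extend-inverse (Inverse.from ω) (Inverse.to ω) (Inverse.strictlyInverseˡ ω))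
    (extend-inverse (Inverse.to ω) (Inverse.from ω) (Inverse.strictlyInverseʳ ω))

module Construction {Σ' : Signature} {A : Set} (𝔄 : Str Σ' A) (Π : OneType {Σ'} → Bool)
  (B : A → Bool) (group : IsGroup 𝔄 Π B) (ω : Permutation (Elem B)) where

  σ : A ↔ A
  σ = extendPermutation B (↔-sym ω)

  private
    ≡true⇒T : ∀ {b} → b ≡ true → T b
    ≡true⇒T = Equivalence.from T-≡

  group-tp₁ : ∀ {x y} → B x ≡ true → B y ≡ true → tp₁ 𝔄 x ≡ tp₁ 𝔄 y
  group-tp₁ x∈B y∈B = proj₁ (group _ _ (≡true⇒T x∈B) (≡true⇒T y∈B))

  σ-tp₁ : ∀ x → tp₁ 𝔄 (Inverse.to σ x) ≡ tp₁ 𝔄 x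
  σ-tp₁ x with T? (B x)
  ... | yes x∈B = sym (proj₁ (group x _ x∈B (proj₂ (Inverse.from ω (x , x∈B)))))
  ... | no  _   = refl

  inΠ : A → Bool
  inΠ x = Π (tp₁ 𝔄 x)

  readThrough : A → A → Bool
  readThrough x y = (not (B x) ∨ inΠ y) ∧ (not (B y) ∨ inΠ x)

  readThrough-sym : ∀ x y → readThrough x y ≡ readThrough y x
  readThrough-sym x y = ∧-comm (not (B x) ∨ inΠ y) (not (B y) ∨ inΠ x)

  open Twisting 𝔄 σ σ-tp₁ readThrough readThrough-sym public
  open RowTransport twisted 𝔄 using (sameProfile-↔; sameCount-↔)

  twistIf-∉B : ∀ {x} → B x ≡ false → ∀ c → twistIf c x ≡ x
  twistIf-∉B x∉B true  = extend-∉ B (Inverse.from ω) (subst T x∉B)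
  twistIf-∉B x∉B false = refl

  group-inΠ : ∀ {x y} → B x ≡ true → B y ≡ true → inΠ x ≡ inΠ y
  group-inΠ x∈B y∈B = cong Π (group-tp₁ x∈B y∈B)

  readThrough-∈Π∖B : ∀ {x y} → B y ≡ false → inΠ y ≡ true → readThrough x y ≡ true
  readThrough-∈Π∖B {x} y∉B y∈Π =
    trans (cong₂ (λ b p → (not (B x) ∨ p) ∧ (not b ∨ inΠ x)) y∉B y∈Π)
          (trans (∧-identityʳ _) (∨-zeroʳ _))

  readThrough-∉B-∈B : ∀ {x y} → B x ≡ false → B y ≡ true → readThrough x y ≡ inΠ x
  readThrough-∉B-∈B {x} {y} x∉B y∈B = cong₂ (λ b b' → (not b ∨ inΠ y) ∧ (not b' ∨ inΠ x)) x∉B y∈B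

  readThrough-∈B-∉Π : ∀ {x y} → B x ≡ true → inΠ y ≡ false → readThrough x y ≡ false
  readThrough-∈B-∉Π {x} {y} x∈B y∉Π = cong₂ (λ b p → (not b ∨ p) ∧ (not (B y) ∨ inΠ x)) x∈B y∉Π

  readThrough-∈B-∈Π : ∀ {x y} → B x ≡ true → inΠ y ≡ true → readThrough x y ≡ true
  readThrough-∈B-∈Π {x} {y} x∈B y∈Π =
    trans (cong₂ (λ b p → (not b ∨ p) ∧ (not (B y) ∨ inΠ x)) x∈B y∈Π) (partner-∈Π (B y) refl)
    where
    partner-∈Π : ∀ b → B y ≡ b → not b ∨ inΠ x ≡ true
    partner-∈Π true  y∈B = trans (group-inΠ x∈B y∈B) y∈Π
    partner-∈Π false _   = refl

  twistIf-readThrough-∉Π : ∀ {x y} → inΠ y ≡ false → twistIf (readThrough x y) x ≡ x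
  twistIf-readThrough-∉Π {x} {y} y∉Π = fixes (B x) refl
    where
    fixes : ∀ b → B x ≡ b → twistIf (readThrough x y) x ≡ x
    fixes true  x∈B = cong (λ c → twistIf c x) (readThrough-∈B-∉Π x∈B y∉Π)
    fixes false x∉B = twistIf-∉B x∉B (readThrough x y)

  ReadThroughCommonMap : A → A → A → Set
  ReadThroughCommonMap a a' a'' = Σ Bool λ c →
    tp₂ twisted a a' ≡ tp₂ 𝔄 (twistIf c a) (twistIf c a') ×
    tp₂ twisted a' a'' ≡ tp₂ 𝔄 (twistIf c a') (twistIf c a'')

  pathReading : ∀ a a' a'' → inΠ a ≡ inΠ a'' →
    tp₁ 𝔄 a ≡ tp₁ 𝔄 a' ⊎ tp₁ 𝔄 a' ≡ tp₁ 𝔄 a'' ⊎ ReadThroughCommonMap a a' a''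
  pathReading a a' a'' a≈a'' = middle (B a') refl
    where
    Outcome : Set
    Outcome = tp₁ 𝔄 a ≡ tp₁ 𝔄 a' ⊎ tp₁ 𝔄 a' ≡ tp₁ 𝔄 a'' ⊎ ReadThroughCommonMap a a' a''
    middle-∉B : B a' ≡ false → ∀ p → inΠ a' ≡ p → Outcome
    middle-∉B a'∉B true a'∈Π = inj₂ (inj₂ (true ,
      twistedBy-κ (readThrough-∈Π∖B a'∉B a'∈Π) ,
      twistedBy-κ (trans (readThrough-sym a' a'') (readThrough-∈Π∖B a'∉B a'∈Π))))
    middle-∉B a'∉B false a'∉Π = inj₂ (inj₂ (false ,
      twistedBy false (twistIf-readThrough-∉Π a'∉Π) (twistIf-∉B a'∉B (readThrough a a')) ,
      twistedBy false (twistIf-∉B a'∉B (readThrough a' a''))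
        (trans (cong (λ c → twistIf c a'') (readThrough-sym a' a''))
               (twistIf-readThrough-∉Π a'∉Π))))
    ends : B a' ≡ true → ∀ b b'' → B a ≡ b → B a'' ≡ b'' → Outcome
    ends a'∈B true  _     a∈B   _     = inj₁ (group-tp₁ a∈B a'∈B)
    ends a'∈B false true  _     a''∈B = inj₂ (inj₁ (group-tp₁ a'∈B a''∈B))
    ends a'∈B false false a∉B   a''∉B = inj₂ (inj₂ (inΠ a ,
      twistedBy-κ (readThrough-∉B-∈B a∉B a'∈B) ,
      twistedBy-κ (trans (readThrough-sym a' a'')
                         (trans (readThrough-∉B-∈B a''∉B a'∈B) (sym a≈a'')))))
    middle : ∀ b' → B a' ≡ b' → Outcome
    middle true  a'∈B = ends a'∈B (B a) (B a'') refl refl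
    middle false a'∉B = middle-∉B a'∉B (inΠ a') refl

  twisted-chromatic : Chromatic 𝔄 → Chromatic twisted
  twisted-chromatic chromatic = twisted-chromatic₁ chromatic , chromatic₂
    where
    chromatic₂ : ∀ a a' a'' → a ≢ a' → a' ≢ a'' → a ≢ a'' →
      IsInvertible (tp₂ twisted a a') → IsInvertible (tp₂ twisted a' a'') →
      tp₁ twisted a ≢ tp₁ twisted a''
    chromatic₂ a a' a'' a≢a' a'≢a'' a≢a'' inv inv' same
      with pathReading a a' a''
             (cong Π (trans (sym (tp₁-twisted a)) (trans same (tp₁-twisted a''))))
    ... | inj₁ a≈a' = twisted-chromatic₁ chromatic a a' a≢a' inv
                        (trans (tp₁-twisted a) (trans a≈a' (sym (tp₁-twisted a'))))
    ... | inj₂ (inj₁ a'≈a'') = twisted-chromatic₁ chromatic a' a'' a'≢a'' inv'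
                        (trans (tp₁-twisted a') (trans a'≈a'' (sym (tp₁-twisted a''))))
    ... | inj₂ (inj₂ (c , read₁ , read₂)) =
      chromatic₂-transfer (twistIf c) (twistIf-injective c) chromatic a≢a' a'≢a'' a≢a''
        read₁ read₂ inv inv' same

  outside-profile : ∀ Π₀ {a} → B a ≡ false → SameProfile Π₀ twisted a 𝔄 a
  outside-profile Π₀ {a} a∉B =
    sameProfile-↔ Π₀ (twistBy (readThrough a) readThrough-σ) (fixed a)
      (λ y → tp₁-twistIf (readThrough a y) y) row
    where
    readThrough-σ : ∀ y → readThrough a (Inverse.to σ y) ≡ readThrough a y
    readThrough-σ y = cong₂ (λ b p → (not (B a) ∨ p) ∧ (not b ∨ inΠ a))
      (extend-B B (Inverse.from ω) y) (cong Π (σ-tp₁ y))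
    fixed : ∀ y → twistIf (readThrough a y) a ≡ a
    fixed y = twistIf-∉B a∉B (readThrough a y)
    row : ∀ y → T (Π₀ (tp₁ twisted y)) → tp₂ twisted a y ≡ tp₂ 𝔄 a (twistIf (readThrough a y) y)
    row y _ = trans (tp₂-twisted a y) (cong (λ z → tp₂ 𝔄 z (twistIf (readThrough a y) y)) (fixed y))

  complement-profile : ∀ a → SameProfile (complement Π) twisted a 𝔄 a
  complement-profile a = byMembership (B a) refl
    where
    byMembership : ∀ b → B a ≡ b → SameProfile (complement Π) twisted a 𝔄 a
    byMembership false a∉B = outside-profile (complement Π) a∉B
    byMembership true  a∈B = sameProfile-↔ (complement Π) (↔-id A) refl
      (sym ∘ tp₁-twisted) λ y y∉Π → twistedBy-κ (readThrough-∈B-∉Π a∈B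
        (trans (cong Π (sym (tp₁-twisted y))) (Equivalence.to T-not-≡ y∉Π)))

  inside-row : ∀ {a} → B a ≡ true → ∀ y → T (Π (tp₁ twisted y)) →
    tp₂ twisted a y ≡ tp₂ 𝔄 (Inverse.to σ a) (Inverse.to σ y)
  inside-row a∈B y y∈Π = twistedBy-κ (readThrough-∈B-∈Π a∈B
    (trans (cong Π (sym (tp₁-twisted y))) (Equivalence.to T-≡ y∈Π)))

  inside-profile : ∀ {a} → B a ≡ true → SameProfile Π twisted a 𝔄 (Inverse.to σ a)
  inside-profile a∈B = sameProfile-↔ Π σ refl (tp₁-twistIf true) (inside-row a∈B)

  inside-count : ∀ {a} → B a ≡ true → SameCount Π twisted a 𝔄 a
  inside-count {a} a∈B h = sameCard-trans
    (sameCount-↔ Π σ refl (tp₁-twistIf true) (inside-row a∈B) h)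
    (proj₂ (group _ a (≡true⇒T (trans (extend-B B (Inverse.from ω) a) a∈B)) (≡true⇒T a∈B)) h)

  permuted-profile : ∀ (b : Elem B) → SameProfile Π twisted (proj₁ (Inverse.to ω b)) 𝔄 (proj₁ b)
  permuted-profile b = subst (SameProfile Π twisted a 𝔄) σa≡b
    (inside-profile (Equivalence.to T-≡ (proj₂ (Inverse.to ω b))))
    where
    a = proj₁ (Inverse.to ω b)
    σa≡b : Inverse.to σ a ≡ proj₁ b
    σa≡b = trans (extend-∈ B (Inverse.from ω) (proj₂ (Inverse.to ω b)))
                 (cong proj₁ (Inverse.strictlyInverseʳ ω b))

lemma21 : (Σ' : Signature) (A : Set) → Countable A → (𝔄 : Str Σ' A) →
    FinitelyBranching 𝔄 → Chromatic 𝔄 →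
    (Π : OneType {Σ'} → Bool) → (B : A → Bool) → IsGroup 𝔄 Π B →
    (ω : Permutation (Elem B)) →
    Σ (Str Σ' A) λ 𝔄' → IsApproximation Π B 𝔄' 𝔄 ×
      (∀ (b : Elem B) → SameProfile Π 𝔄' (proj₁ (Inverse.to ω b)) 𝔄 (proj₁ b))
lemma21 Σ' A _ 𝔄 _ chromatic Π B group ω =
  twisted ,
  ( twisted-chromatic chromatic
  , twisted-realizes
  , λ a → tp₁-twisted a , complement-profile a , outside-profile allTypes , inside-count) ,
  permuted-profile
  where open Construction 𝔄 Π B group ω
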